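{- Let $G$ be a cograph with $\chi(G)=k$. The following are equivalent: (1) $G$ is tight; (2) there is a $k$-coloring $\phi:V(G)\to k$ of $G$ that is tight; (3) every maximal clique $X\subseteq V(G)$ has $|X|=k$; (4) $G$ is strongly-cliqued; (5) $G$ is weakly-cliqued.
   Context: Cographs are the smallest class of finite graphs containing all one-vertex graphs and closed under complements and disjoint unions (equivalently, finite graphs with no induced path on 4 vertices). A $k$-coloring is a proper coloring $V\to k=\{0,\dots,k-1\}$. A $k$-coloring $\phi$ is tight if for every vertex $v$ and every color $c\ne\phi(v)$ there is a neighbor $u$ of $v$ with $\phi(u)=c$; $G$ is tight if all its $\chi(G)$-colorings are tight. $G$ is weakly-cliqued if every vertex lies in a clique of size $k$; $G$ is strongly-cliqued if it has no isolated vertices and every edge lies in a clique of size $k$. -}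

module Defs where

open import Data.Nat using (ℕ; _+_; _≤_)
open import Data.Bool using (Bool; true; false; not)
open import Data.Fin using (Fin; _↑ˡ_; _↑ʳ_)
open import Data.Fin.Subset using (Subset; _∈_; _⊆_; ∣_∣)
open import Data.Fin.Permutation using (Permutation′; _⟨$⟩ʳ_)
open import Data.Product using (Σ; ∃; _×_)
open import Relation.Binary.PropositionalEquality using (_≡_; _≢_)

record Graph (n : ℕ) : Set where
  field
    Adj   : Fin n → Fin n → Bool
    sym   : ∀ i j → Adj i j ≡ Adj j i
    irrefl : ∀ i → Adj i i ≡ false
open Graph public

data IsCograph : {n : ℕ} → Graph n → Set where
  single : (G : Graph 1) → IsCograph G
  complement : ∀ {n} {G H : Graph n} → IsCograph G →
    (∀ i j → i ≢ j → Adj H i j ≡ not (Adj G i j)) → IsCograph H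
  union : ∀ {m n} {G₁ : Graph m} {G₂ : Graph n} {H : Graph (m + n)} →
    IsCograph G₁ → IsCograph G₂ →
    (∀ a b → Adj H (a ↑ˡ n) (b ↑ˡ n) ≡ Adj G₁ a b) →
    (∀ a b → Adj H (m ↑ʳ a) (m ↑ʳ b) ≡ Adj G₂ a b) →
    (∀ a b → Adj H (a ↑ˡ n) (m ↑ʳ b) ≡ false) →
    IsCograph H
  relabel : ∀ {n} {G H : Graph n} → IsCograph G → (σ : Permutation′ n) →
    (∀ i j → Adj H i j ≡ Adj G (σ ⟨$⟩ʳ i) (σ ⟨$⟩ʳ j)) → IsCograph H

module _ {n : ℕ} (G : Graph n) where

  IsColoring : (k : ℕ) → (Fin n → Fin k) → Set
  IsColoring k φ = ∀ u v → Adj G u v ≡ true → φ u ≢ φ v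

  Colorable : ℕ → Set
  Colorable k = Σ (Fin n → Fin k) (IsColoring k)

  ChromaticNumber : ℕ → Set
  ChromaticNumber k = Colorable k × (∀ m → Colorable m → k ≤ m)

  IsTightColoring : (k : ℕ) → (Fin n → Fin k) → Set
  IsTightColoring k φ =
    ∀ v (c : Fin k) → c ≢ φ v → ∃ λ u → Adj G v u ≡ true × φ u ≡ c

  IsTight : ℕ → Set
  IsTight k = ∀ φ → IsColoring k φ → IsTightColoring k φ

  IsClique : Subset n → Set
  IsClique X = ∀ u v → u ∈ X → v ∈ X → u ≢ v → Adj G u v ≡ true

  IsMaximalClique : Subset n → Set
  IsMaximalClique X = IsClique X × (∀ Y → IsClique Y → X ⊆ Y → Y ⊆ X)

  WeaklyCliqued : ℕ → Set
  WeaklyCliqued k = ∀ v → ∃ λ X → IsClique X × v ∈ X × ∣ X ∣ ≡ k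

  StronglyCliqued : ℕ → Set
  StronglyCliqued k =
    (∀ v → ∃ λ u → Adj G v u ≡ true) ×
    (∀ u v → Adj G u v ≡ true → ∃ λ X → IsClique X × u ∈ X × v ∈ X × ∣ X ∣ ≡ k)

{-# OPTIONS --safe #-}
module Submission where

-- In a cograph, every tight colouring has the clique extension property: a clique
-- missing a colour c has a common neighbour of colour c. This is proved along the
-- construction of the cograph, for the graph and its complement at once. A clique
-- of a disjoint union lies in one part, where the colouring is still tight; in a
-- join, the part that uses c is tightly coloured by its own colours, which the
-- other part cannot use. So a maximal clique sees every colour and has exactly k
-- vertices. Conversely, a k-clique through v carries all k colours, so v sees
-- every other colour among its neighbours.

open import Defs hiding (sym)
open import Data.Nat using (ℕ; zero; suc; _+_; _≤_; _<_; s≤s)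
open import Data.Nat.Properties using (≤-antisym; ≤-reflexive; <⇒≱; module ≤-Reasoning)
open import Data.Bool using (true; false; not)
open import Data.Bool.Properties using (not-injective; not-¬) renaming (_≟_ to _≟ᵇ_)
open import Data.Fin using (Fin; zero; suc; _↑ˡ_; _↑ʳ_; splitAt; join; punchOut)
open import Data.Fin.Properties
  using (_≟_; any?; all?; suc-injective; ↑ˡ-injective; ↑ʳ-injective; join-splitAt; punchOut-injective; injective⇒≤)
open import Data.Fin.Permutation using (Permutation′; _⟨$⟩ʳ_; _⟨$⟩ˡ_; inverseˡ; inverseʳ)
open import Data.Fin.Subset using (Subset; inside; outside; _∈_; _⊆_; _⊂_; _⊃_; ∣_∣; _∪_; ⁅_⁆)
open import Data.Fin.Subset.Properties
  using (_∈?_; x∈p∪q⁻; x∈p∪q⁺; p⊆p∪q; x∈⁅x⁆; x∈⁅y⁆⇒x≡y; p⊆q⇒∣p∣≤∣q∣; ∣⁅x⁆∣≡1)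
open import Data.Fin.Subset.Induction using (Acc; acc; ⊃-wellFounded)
open import Data.Vec using (_∷_; here; there)
open import Data.Product using (Σ; ∃; _×_; _,_; proj₁; proj₂; map; map₁; map₂)
open import Data.Sum using (inj₁; inj₂)
open import Data.Unit using (⊤; tt)
open import Data.Empty using (⊥-elim)
open import Function using (_∘_; _on_)
open import Function.Bundles using (_⇔_; mk⇔)
open import Function.Definitions using (Injective)
open import Level using (0ℓ)
open import Relation.Nullary using (¬_; yes; no)
open import Relation.Nullary.Decidable using (_×-dec_; _→-dec_; ¬?)
open import Relation.Unary using (Pred; Decidable)
open import Relation.Binary.Core using (Rel; _⇒_)
open import Relation.Binary.PropositionalEquality
  using (_≡_; _≢_; refl; sym; trans; cong; cong₂; subst)

private
  variable
    k m m′ n N : ℕ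

enumerate : (X : Subset n) → Fin ∣ X ∣ → Fin n
enumerate (outside ∷ X) i       = suc (enumerate X i)
enumerate (inside ∷ X)  zero    = zero
enumerate (inside ∷ X)  (suc i) = suc (enumerate X i)

enumerate-∈ : (X : Subset n) (i : Fin ∣ X ∣) → enumerate X i ∈ X
enumerate-∈ (outside ∷ X) i       = there (enumerate-∈ X i)
enumerate-∈ (inside ∷ X)  zero    = here
enumerate-∈ (inside ∷ X)  (suc i) = there (enumerate-∈ X i)

enumerate-injective : (X : Subset n) → Injective _≡_ _≡_ (enumerate X)
enumerate-injective (outside ∷ X) e = enumerate-injective X (suc-injective e)
enumerate-injective (inside ∷ X) {zero}  {zero}  e = refl
enumerate-injective (inside ∷ X) {suc i} {suc j} e = cong suc (enumerate-injective X (suc-injective e))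

enumerate-surjective : (X : Subset n) {x : Fin n} → x ∈ X → ∃ λ i → enumerate X i ≡ x
enumerate-surjective (inside ∷ X)  here        = zero , refl
enumerate-surjective (outside ∷ X) (there x∈X) = map₂ (cong suc) (enumerate-surjective X x∈X)
enumerate-surjective (inside ∷ X)  (there x∈X) = map suc (cong suc) (enumerate-surjective X x∈X)

InjectiveOn : Subset n → (Fin n → Fin k) → Set
InjectiveOn X f = ∀ {x y} → x ∈ X → y ∈ X → f x ≡ f y → x ≡ y

SurjectiveOn : Subset n → (Fin n → Fin k) → Set
SurjectiveOn {k = k} X f = ∀ (c : Fin k) → ∃ λ x → x ∈ X × f x ≡ c

injectiveOn⇒∣p∣≤ : (X : Subset n) {f : Fin n → Fin k} → InjectiveOn X f → ∣ X ∣ ≤ k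
injectiveOn⇒∣p∣≤ X inj =
  injective⇒≤ (λ e → enumerate-injective X (inj (enumerate-∈ X _) (enumerate-∈ X _) e))

surjectiveOn⇒≤∣p∣ : (X : Subset n) {f : Fin n → Fin k} → SurjectiveOn X f → k ≤ ∣ X ∣
surjectiveOn⇒≤∣p∣ X {f} onto = injective⇒≤ index-injective
  where
  index : Fin _ → Fin ∣ X ∣
  index c = proj₁ (enumerate-surjective X (proj₁ (proj₂ (onto c))))

  f∘enumerate∘index : ∀ c → f (enumerate X (index c)) ≡ c
  f∘enumerate∘index c =
    trans (cong f (proj₂ (enumerate-surjective X _))) (proj₂ (proj₂ (onto c)))

  index-injective : Injective _≡_ _≡_ index
  index-injective {c} {d} e =
    trans (sym (f∘enumerate∘index c)) (trans (cong (f ∘ enumerate X) e) (f∘enumerate∘index d))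

injectiveOn⇒∣p∣<-avoiding : (X : Subset n) {f : Fin n → Fin k} {c : Fin k} →
  InjectiveOn X f → (∀ {x} → x ∈ X → f x ≢ c) → ∣ X ∣ < k
injectiveOn⇒∣p∣<-avoiding {k = suc k} X {f} {c} inj avoid = s≤s (injective⇒≤ punchOut∘f-injective)
  where
  c≢ : ∀ i → c ≢ f (enumerate X i)
  c≢ i = avoid (enumerate-∈ X i) ∘ sym

  punchOut∘f-injective : Injective _≡_ _≡_ (λ i → punchOut (c≢ i))
  punchOut∘f-injective {i} {j} e =
    enumerate-injective X (inj (enumerate-∈ X i) (enumerate-∈ X j) (punchOut-injective (c≢ i) (c≢ j) e))

injectiveOn⇒surjectiveOn : (X : Subset n) {f : Fin n → Fin k} →
  InjectiveOn X f → ∣ X ∣ ≡ k → SurjectiveOn X f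
injectiveOn⇒surjectiveOn X {f} inj ∣X∣≡k c with any? (λ x → x ∈? X ×-dec f x ≟ c)
... | yes hit = hit
... | no miss = ⊥-elim (<⇒≱ (injectiveOn⇒∣p∣<-avoiding X inj (λ x∈X e → miss (_ , x∈X , e)))
                            (≤-reflexive (sym ∣X∣≡k)))

-- Tightness only for the colours of a palette P: one side of a join is tight only for the colours it uses.
record TightColouring (R : Rel (Fin n) 0ℓ) (P : Pred (Fin k) 0ℓ) (φ : Fin n → Fin k) : Set where
  field
    proper : ∀ u v → R u v → φ u ≢ φ v
    tight  : ∀ v c → P c → c ≢ φ v → ∃ λ u → R v u × φ u ≡ c

open TightColouring

IsCliqueOf : Rel (Fin n) 0ℓ → Pred (Fin n) 0ℓ → Set
IsCliqueOf R X = ∀ u v → X u → X v → u ≢ v → R u v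

CliquesExtend : Rel (Fin n) 0ℓ → Set₁
CliquesExtend {n} R =
  ∀ {k P} {φ : Fin n → Fin k} → TightColouring R P φ →
  ∀ X → Decidable X → IsCliqueOf R X →
  ∀ {c} → P c → (∀ u → X u → φ u ≢ c) →
  ∃ λ w → φ w ≡ c × (∀ u → X u → R w u)

cliquesExtend-resp : {R S : Rel (Fin n) 0ℓ} → R ⇒ S → S ⇒ R → CliquesExtend R → CliquesExtend S
cliquesExtend-resp {R = R} R⇒S S⇒R ext {P = P} {φ} T X X? cl Pc missing =
  map₂ (map₂ (λ adj u x → R⇒S (adj u x)))
       (ext T′ X X? (λ u v xu xv u≢v → S⇒R (cl u v xu xv u≢v)) Pc missing)
  where
  T′ : TightColouring R P φ
  T′ = record
    { proper = λ u v r → proper T u v (R⇒S r)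
    ; tight  = λ v c Pc c≢ → map₂ (map₁ S⇒R) (tight T v c Pc c≢)
    }

cliquesExtend-Fin1 : (R : Rel (Fin 1) 0ℓ) → CliquesExtend R
cliquesExtend-Fin1 _ {φ = φ} T _ _ _ {c} Pc missing with φ zero ≟ c
... | yes e = zero , e , λ { zero x0 → ⊥-elim (missing zero x0 e) }
... | no ≢c with tight T zero c Pc (≢c ∘ sym)
...   | zero , _ , e = ⊥-elim (≢c e)

data Side (ι : Fin m → Fin N) (κ : Fin m′ → Fin N) : Fin N → Set where
  inˡ : ∀ a → Side ι κ (ι a)
  inʳ : ∀ b → Side ι κ (κ b)

record Decomposition (N m m′ : ℕ) : Set where
  field
    ι           : Fin m → Fin N
    κ           : Fin m′ → Fin N
    side        : ∀ u → Side ι κ u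
    ι-injective : Injective _≡_ _≡_ ι
    κ-injective : Injective _≡_ _≡_ κ
    ι≢κ         : ∀ a b → ι a ≢ κ b

swap : Decomposition N m m′ → Decomposition N m′ m
swap D = record
  { ι = κ ; κ = ι
  ; side = λ u → flip (side u)
  ; ι-injective = κ-injective ; κ-injective = ι-injective
  ; ι≢κ = λ b a → ι≢κ a b ∘ sym
  }
  where
  open Decomposition D
  flip : ∀ {u} → Side ι κ u → Side κ ι u
  flip (inˡ a) = inʳ a
  flip (inʳ b) = inˡ b

module _ (D : Decomposition N m m′) (R : Rel (Fin N) 0ℓ) where
  open Decomposition D

  Separated : Set
  Separated = ∀ a b → ¬ R (ι a) (κ b)

  Joined : Set
  Joined = ∀ a b → R (ι a) (κ b)

module _ (D : Decomposition N m m′) {R : Rel (Fin N) 0ℓ} {P : Pred (Fin k) 0ℓ} {φ : Fin N → Fin k} where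
  open Decomposition D

  restrict-separated : Separated D R → TightColouring R P φ → TightColouring (R on ι) P (φ ∘ ι)
  restrict-separated sep T = record
    { proper = λ a b → proper T (ι a) (ι b)
    ; tight  = λ a c Pc c≢ → neighbour a (tight T (ι a) c Pc c≢)
    }
    where
    neighbour : ∀ a {c} → (∃ λ u → R (ι a) u × φ u ≡ c) → ∃ λ b → R (ι a) (ι b) × φ (ι b) ≡ c
    neighbour a (u , r , e) with side u
    ... | inˡ b = b , r , e
    ... | inʳ b = ⊥-elim (sep a b r)

  UsedOnι : Pred (Fin k) 0ℓ
  UsedOnι c = P c × ∃ λ a → φ (ι a) ≡ c

  -- A neighbour across the join is adjacent to all of the ι-part, so it carries none of its colours.
  restrict-joined : Joined D R → TightColouring R P φ → TightColouring (R on ι) UsedOnι (φ ∘ ι)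
  restrict-joined jn T = record
    { proper = λ a b → proper T (ι a) (ι b)
    ; tight  = λ a c (Pc , used) c≢ → neighbour used (tight T (ι a) c Pc c≢)
    }
    where
    neighbour : ∀ {a c} → (∃ λ a′ → φ (ι a′) ≡ c) →
      (∃ λ u → R (ι a) u × φ u ≡ c) → ∃ λ b → R (ι a) (ι b) × φ (ι b) ≡ c
    neighbour (a′ , e′) (u , r , e) with side u
    ... | inˡ b = b , r , e
    ... | inʳ b = ⊥-elim (proper T (ι a′) (κ b) (jn a′ b) (trans e′ (sym e)))

  restrict-clique : ∀ {X} → IsCliqueOf R X → IsCliqueOf (R on ι) (X ∘ ι)
  restrict-clique cl a b xa xb a≢b = cl (ι a) (ι b) xa xb (a≢b ∘ ι-injective)

  extendWithinSeparated : Separated D R → CliquesExtend (R on ι) → TightColouring R P φ →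
    ∀ X → Decidable X → IsCliqueOf R X → (∀ b → ¬ X (κ b)) →
    ∀ {c} → P c → (∀ u → X u → φ u ≢ c) →
    ∃ λ w → φ w ≡ c × (∀ u → X u → R w u)
  extendWithinSeparated sep ext T X X? cl X∌κ Pc missing
    with ext (restrict-separated sep T) (X ∘ ι) (X? ∘ ι) (restrict-clique cl) Pc (missing ∘ ι)
  ... | w , e , adj = ι w , e , common
    where
    common : ∀ u → X u → R (ι w) u
    common u xu with side u
    ... | inˡ a = adj a xu
    ... | inʳ b = ⊥-elim (X∌κ b xu)

  extendWithinJoined : Joined D R → CliquesExtend (R on ι) → TightColouring R P φ →
    ∀ X → Decidable X → IsCliqueOf R X →
    ∀ {c} → P c → (∀ u → X u → φ u ≢ c) → (∃ λ a → φ (ι a) ≡ c) →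
    ∃ λ w → φ w ≡ c × (∀ u → X u → R w u)
  extendWithinJoined jn ext T X X? cl Pc missing used
    with ext (restrict-joined jn T) (X ∘ ι) (X? ∘ ι) (restrict-clique cl) (Pc , used) (missing ∘ ι)
  ... | w , e , adj = ι w , e , common
    where
    common : ∀ u → X u → R (ι w) u
    common u xu with side u
    ... | inˡ a = adj a xu
    ... | inʳ b = jn w b

module _ (D : Decomposition N m m′) {R : Rel (Fin N) 0ℓ} where
  open Decomposition D

  cliquesExtend-separated : Separated D R → Separated (swap D) R →
    CliquesExtend (R on ι) → CliquesExtend (R on κ) → CliquesExtend R
  cliquesExtend-separated sepˡ sepʳ extˡ extʳ T X X? cl Pc missing with any? (X? ∘ κ)
  ... | no X∌κ = extendWithinSeparated D sepˡ extˡ T X X? cl (λ b xb → X∌κ (b , xb)) Pc missing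
  ... | yes (b , xb) = extendWithinSeparated (swap D) sepʳ extʳ T X X? cl X∌ι Pc missing
    where
    X∌ι : ∀ a → ¬ X (ι a)
    X∌ι a xa = sepʳ b a (cl (κ b) (ι a) xb xa (ι≢κ a b ∘ sym))

  cliquesExtend-joined : Joined D R → Joined (swap D) R → Fin N →
    CliquesExtend (R on ι) → CliquesExtend (R on κ) → CliquesExtend R
  cliquesExtend-joined jnˡ jnʳ v₀ extˡ extʳ {φ = φ} T X X? cl {c} Pc missing
    with any? (λ a → φ (ι a) ≟ c) | any? (λ b → φ (κ b) ≟ c)
  ... | yes usedˡ | _         = extendWithinJoined D jnˡ extˡ T X X? cl Pc missing usedˡ
  ... | no _      | yes usedʳ = extendWithinJoined (swap D) jnʳ extʳ T X X? cl Pc missing usedʳ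
  ... | no unusedˡ | no unusedʳ =
    let u , _ , φu≡c = tight T v₀ c Pc (unused v₀ ∘ sym) in ⊥-elim (unused u φu≡c)
    where
    unused : ∀ u → φ u ≢ c
    unused u with side u
    ... | inˡ a = λ e → unusedˡ (a , e)
    ... | inʳ b = λ e → unusedʳ (b , e)

↑ˡ≢↑ʳ : (a : Fin m) (b : Fin m′) → a ↑ˡ m′ ≢ m ↑ʳ b
↑ˡ≢↑ʳ {suc m} zero    b ()
↑ˡ≢↑ʳ {suc m} (suc a) b e = ↑ˡ≢↑ʳ a b (suc-injective e)

↑-decomposition : ∀ m m′ → Decomposition (m + m′) m m′
↑-decomposition m m′ = record
  { ι = _↑ˡ m′ ; κ = m ↑ʳ_
  ; side = λ u → subst (Side _ _) (join-splitAt m m′ u) (fromSum (splitAt m u))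
  ; ι-injective = ↑ˡ-injective m′ _ _ ; κ-injective = ↑ʳ-injective m _ _
  ; ι≢κ = ↑ˡ≢↑ʳ
  }
  where
  fromSum : ∀ s → Side (_↑ˡ m′) (m ↑ʳ_) (join m m′ s)
  fromSum (inj₁ a) = inˡ a
  fromSum (inj₂ b) = inʳ b

⟨$⟩ˡ-injective : (σ : Permutation′ n) → Injective _≡_ _≡_ (σ ⟨$⟩ˡ_)
⟨$⟩ˡ-injective σ e = trans (sym (inverseʳ σ)) (trans (cong (σ ⟨$⟩ʳ_) e) (inverseʳ σ))

-- A relabelling is a decomposition whose second part is empty.
permutation-decomposition : Permutation′ n → Decomposition n n 0
permutation-decomposition σ = record
  { ι = σ ⟨$⟩ˡ_ ; κ = λ ()
  ; side = λ u → subst (Side _ _) (inverseˡ σ) (inˡ (σ ⟨$⟩ʳ u))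
  ; ι-injective = ⟨$⟩ˡ-injective σ ; κ-injective = λ { {()} }
  ; ι≢κ = λ _ ()
  }

cliquesExtend-relabel : {R : Rel (Fin n) 0ℓ} (σ : Permutation′ n) →
  CliquesExtend (R on (σ ⟨$⟩ˡ_)) → CliquesExtend R
cliquesExtend-relabel σ ext T X X? cl =
  extendWithinSeparated (permutation-decomposition σ) (λ _ ()) ext T X X? cl (λ ())

Edge : Graph n → Rel (Fin n) 0ℓ
Edge G u v = Adj G u v ≡ true

NonEdge : Graph n → Rel (Fin n) 0ℓ
NonEdge G u v = u ≢ v × Adj G u v ≡ false

CliquesExtendBoth : Graph n → Set₁
CliquesExtendBoth G = CliquesExtend (Edge G) × CliquesExtend (NonEdge G)

edge⇒≢ : (G : Graph n) {u v : Fin n} → Edge G u v → u ≢ v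
edge⇒≢ G e refl = not-¬ e (irrefl G _)

cliquesExtendBoth-complement : {G H : Graph n} → (∀ i j → i ≢ j → Adj H i j ≡ not (Adj G i j)) →
  CliquesExtendBoth G → CliquesExtendBoth H
cliquesExtendBoth-complement {G = G} {H} h (ext , extᶜ) =
  cliquesExtend-resp (λ (u≢v , e) → trans (h _ _ u≢v) (cong not e))
                     (λ e → edge⇒≢ H e , not-injective (trans (sym (h _ _ (edge⇒≢ H e))) e))
                     extᶜ ,
  cliquesExtend-resp (λ e → edge⇒≢ G e , trans (h _ _ (edge⇒≢ G e)) (cong not e))
                     (λ (u≢v , e) → not-injective (trans (sym (h _ _ u≢v)) e))
                     ext

cliquesExtendBoth-induced : {G : Graph m} {H : Graph N} {ι : Fin m → Fin N} →
  Injective _≡_ _≡_ ι → (∀ a b → Adj H (ι a) (ι b) ≡ Adj G a b) →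
  CliquesExtendBoth G → CliquesExtend (Edge H on ι) × CliquesExtend (NonEdge H on ι)
cliquesExtendBoth-induced {ι = ι} ι-injective h (ext , extᶜ) =
  cliquesExtend-resp (λ e → trans (h _ _) e) (λ e → trans (sym (h _ _)) e) ext ,
  cliquesExtend-resp (λ (a≢b , e) → a≢b ∘ ι-injective , trans (h _ _) e)
                     (λ (ιa≢ιb , e) → ιa≢ιb ∘ cong ι , trans (sym (h _ _)) e)
                     extᶜ

cograph-vertex : {G : Graph n} → IsCograph G → Fin n
cograph-vertex (single _)                 = zero
cograph-vertex (complement c _)           = cograph-vertex c
cograph-vertex (union {n = m′} c _ _ _ _) = cograph-vertex c ↑ˡ m′
cograph-vertex (relabel c _ _)            = cograph-vertex c

-- The clique extension property must be carried for the complement as well,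
-- since the complement of a disjoint union is a join.
cograph⇒cliquesExtendBoth : {G : Graph n} → IsCograph G → CliquesExtendBoth G
cograph⇒cliquesExtendBoth (single _) = cliquesExtend-Fin1 _ , cliquesExtend-Fin1 _
cograph⇒cliquesExtendBoth {G = H} (complement {G = G} c h) =
  cliquesExtendBoth-complement {G = G} {H} h (cograph⇒cliquesExtendBoth c)
cograph⇒cliquesExtendBoth {G = H} (union {m} {m′} {G₁} {G₂} c₁ c₂ h₁ h₂ h₃)
  with cliquesExtendBoth-induced {G = G₁} {H = H} (↑ˡ-injective m′ _ _) h₁ (cograph⇒cliquesExtendBoth c₁)
     | cliquesExtendBoth-induced {G = G₂} {H = H} (↑ʳ-injective m _ _) h₂ (cograph⇒cliquesExtendBoth c₂)
... | ext₁ , extᶜ₁ | ext₂ , extᶜ₂ =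
  cliquesExtend-separated D
    (λ a b e → not-¬ e (h₃ a b))
    (λ b a e → not-¬ e (trans (Graph.sym H _ _) (h₃ a b)))
    ext₁ ext₂ ,
  cliquesExtend-joined D
    (λ a b → ↑ˡ≢↑ʳ a b , h₃ a b)
    (λ b a → ↑ˡ≢↑ʳ a b ∘ sym , trans (Graph.sym H _ _) (h₃ a b))
    (cograph-vertex c₁ ↑ˡ m′)
    extᶜ₁ extᶜ₂
  where
  D : Decomposition (m + m′) m m′
  D = ↑-decomposition m m′
cograph⇒cliquesExtendBoth {G = H} (relabel {G = G} c σ h) =
  map (cliquesExtend-relabel σ) (cliquesExtend-relabel σ)
      (cliquesExtendBoth-induced {G = G} {H = H} (⟨$⟩ˡ-injective σ)
        (λ a b → trans (h _ _) (cong₂ (Adj G) (inverseʳ σ) (inverseʳ σ)))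
        (cograph⇒cliquesExtendBoth c))

module _ (G : Graph n) where
  open ≤-Reasoning

  ⁅⁆-clique : ∀ v → IsClique G ⁅ v ⁆
  ⁅⁆-clique v a b a∈ b∈ a≢b = ⊥-elim (a≢b (trans (x∈⁅y⁆⇒x≡y v a∈) (sym (x∈⁅y⁆⇒x≡y v b∈))))

  clique-∪-⁅⁆ : ∀ X w → IsClique G X → (∀ x → x ∈ X → Adj G w x ≡ true) → IsClique G (X ∪ ⁅ w ⁆)
  clique-∪-⁅⁆ X w cl adj u v u∈ v∈ u≢v with x∈p∪q⁻ X ⁅ w ⁆ u∈ | x∈p∪q⁻ X ⁅ w ⁆ v∈
  ... | inj₁ u∈X | inj₁ v∈X = cl u v u∈X v∈X u≢v
  ... | inj₁ u∈X | inj₂ v∈⁅w⁆ rewrite x∈⁅y⁆⇒x≡y w v∈⁅w⁆ = trans (Graph.sym G u w) (adj u u∈X)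
  ... | inj₂ u∈⁅w⁆ | inj₁ v∈X rewrite x∈⁅y⁆⇒x≡y w u∈⁅w⁆ = adj v v∈X
  ... | inj₂ u∈⁅w⁆ | inj₂ v∈⁅w⁆ =
    ⊥-elim (u≢v (trans (x∈⁅y⁆⇒x≡y w u∈⁅w⁆) (sym (x∈⁅y⁆⇒x≡y w v∈⁅w⁆))))

  extendToMaximal : ∀ X → IsClique G X → ∃ λ Y → IsMaximalClique G Y × X ⊆ Y
  extendToMaximal X cl = go X cl (⊃-wellFounded X)
    where
    go : ∀ X → IsClique G X → Acc _⊃_ X → ∃ λ Y → IsMaximalClique G Y × X ⊆ Y
    go X cl (acc rec)
      with any? (λ w → ¬? (w ∈? X) ×-dec all? (λ x → x ∈? X →-dec (Adj G w x ≟ᵇ true)))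
    ... | yes (w , w∉X , adj) =
      map₂ (map₂ (λ sub x∈X → sub (p⊆p∪q ⁅ w ⁆ x∈X)))
          (go (X ∪ ⁅ w ⁆) (clique-∪-⁅⁆ X w cl adj) (rec X⊂X∪⁅w⁆))
      where
      X⊂X∪⁅w⁆ : X ⊂ X ∪ ⁅ w ⁆
      X⊂X∪⁅w⁆ = p⊆p∪q ⁅ w ⁆ , w , x∈p∪q⁺ (inj₂ (x∈⁅x⁆ w)) , w∉X
    ... | no noExtension = X , (cl , maximal) , λ x∈X → x∈X
      where
      maximal : ∀ Y → IsClique G Y → X ⊆ Y → Y ⊆ X
      maximal Y clY X⊆Y {y} y∈Y with y ∈? X
      ... | yes y∈X = y∈X
      ... | no y∉X = ⊥-elim (noExtension (y , y∉X , λ x x∈X →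
                       clY y x y∈Y (X⊆Y x∈X) (λ { refl → y∉X x∈X })))

  colouring-injectiveOn-clique : ∀ {k} {φ : Fin n → Fin k} {X} →
    IsColoring G k φ → IsClique G X → InjectiveOn X φ
  colouring-injectiveOn-clique col cl {u} {v} u∈X v∈X φu≡φv with u ≟ v
  ... | yes u≡v = u≡v
  ... | no u≢v = ⊥-elim (col u v (cl u v u∈X v∈X u≢v) φu≡φv)

  -- A colour missing from a maximal clique would extend it.
  maximalClique-surjectiveOn : ∀ {k} {φ : Fin n → Fin k} {X} → CliquesExtend (Edge G) →
    IsColoring G k φ → IsTightColoring G k φ → IsMaximalClique G X → SurjectiveOn X φ
  maximalClique-surjectiveOn {φ = φ} {X} ext col tight (cl , maximal) c
    with any? (λ u → u ∈? X ×-dec φ u ≟ c)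
  ... | yes hit = hit
  ... | no miss =
    let w , φw≡c , adj = ext T (_∈ X) (_∈? X) cl tt (λ u u∈X φu≡c → miss (u , u∈X , φu≡c))
        w∈X = maximal (X ∪ ⁅ w ⁆) (clique-∪-⁅⁆ X w cl adj) (p⊆p∪q ⁅ w ⁆) (x∈p∪q⁺ (inj₂ (x∈⁅x⁆ w)))
    in ⊥-elim (miss (w , w∈X , φw≡c))
    where
    T : TightColouring (Edge G) (λ _ → ⊤) φ
    T = record { proper = col ; tight = λ v c _ → tight v c }

  tightColouring⇒maximalCliques : ∀ {k} → IsCograph G →
    Σ (Fin n → Fin k) (λ φ → IsColoring G k φ × IsTightColoring G k φ) →
    ∀ X → IsMaximalClique G X → ∣ X ∣ ≡ k
  tightColouring⇒maximalCliques cog (φ , col , tight) X maxX =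
    ≤-antisym (injectiveOn⇒∣p∣≤ X (colouring-injectiveOn-clique col (proj₁ maxX)))
              (surjectiveOn⇒≤∣p∣ X (maximalClique-surjectiveOn ext col tight maxX))
    where
    ext : CliquesExtend (Edge G)
    ext = proj₁ (cograph⇒cliquesExtendBoth cog)

  maximalCliques⇒stronglyCliqued : ∀ {k} → 2 ≤ k →
    (∀ X → IsMaximalClique G X → ∣ X ∣ ≡ k) → StronglyCliqued G k
  maximalCliques⇒stronglyCliqued {k} 2≤k size = neighbour , edgeInClique
    where
    neighbour : ∀ v → ∃ λ u → Adj G v u ≡ true
    neighbour v with extendToMaximal ⁅ v ⁆ (⁅⁆-clique v)
    ... | Y , maxY , ⁅v⁆⊆Y with any? (λ u → u ∈? Y ×-dec ¬? (u ≟ v))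
    ...   | yes (u , u∈Y , u≢v) = u , proj₁ maxY v u (⁅v⁆⊆Y (x∈⁅x⁆ v)) u∈Y (u≢v ∘ sym)
    ...   | no onlyV = ⊥-elim (<⇒≱ 2≤k k≤1)
      where
      Y⊆⁅v⁆ : Y ⊆ ⁅ v ⁆
      Y⊆⁅v⁆ {y} y∈Y with y ≟ v
      ... | yes refl = x∈⁅x⁆ v
      ... | no y≢v = ⊥-elim (onlyV (y , y∈Y , y≢v))

      k≤1 : k ≤ 1
      k≤1 = begin
        k         ≡⟨ sym (size Y maxY) ⟩
        ∣ Y ∣     ≤⟨ p⊆q⇒∣p∣≤∣q∣ Y⊆⁅v⁆ ⟩
        ∣ ⁅ v ⁆ ∣ ≡⟨ ∣⁅x⁆∣≡1 v ⟩
        1         ∎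

    edgeInClique : ∀ u v → Adj G u v ≡ true → ∃ λ X → IsClique G X × u ∈ X × v ∈ X × ∣ X ∣ ≡ k
    edgeInClique u v e with extendToMaximal (⁅ u ⁆ ∪ ⁅ v ⁆) (clique-∪-⁅⁆ ⁅ u ⁆ v (⁅⁆-clique u) v~⁅u⁆)
      where
      v~⁅u⁆ : ∀ x → x ∈ ⁅ u ⁆ → Adj G v x ≡ true
      v~⁅u⁆ x x∈⁅u⁆ rewrite x∈⁅y⁆⇒x≡y u x∈⁅u⁆ = trans (Graph.sym G v u) e
    ... | Y , maxY , sub =
      Y , proj₁ maxY , sub (x∈p∪q⁺ (inj₁ (x∈⁅x⁆ u))) , sub (x∈p∪q⁺ (inj₂ (x∈⁅x⁆ v))) , size Y maxY

  stronglyCliqued⇒weaklyCliqued : ∀ {k} → StronglyCliqued G k → WeaklyCliqued G k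
  stronglyCliqued⇒weaklyCliqued (neighbour , edgeInClique) v =
    let u , v~u = neighbour v
        X , cl , v∈X , _ , ∣X∣≡k = edgeInClique v u v~u
    in X , cl , v∈X , ∣X∣≡k

  weaklyCliqued⇒tight : ∀ {k} → WeaklyCliqued G k → IsTight G k
  weaklyCliqued⇒tight wc φ col v c c≢φv =
    let X , cl , v∈X , ∣X∣≡k = wc v
        u , u∈X , φu≡c = injectiveOn⇒surjectiveOn X (colouring-injectiveOn-clique col cl) ∣X∣≡k c
    in u , cl v u v∈X u∈X (λ v≡u → c≢φv (trans (sym φu≡c) (cong φ (sym v≡u)))) , φu≡c

cycle⇒equivalences : {A B C D E : Set} → (A → B) → (B → C) → (C → D) → (D → E) → (E → A) →
  (A ⇔ B) × (A ⇔ C) × (A ⇔ D) × (A ⇔ E)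
cycle⇒equivalences f g h i j =
  mk⇔ f (j ∘ i ∘ h ∘ g) ,
  mk⇔ (g ∘ f) (j ∘ i ∘ h) ,
  mk⇔ (h ∘ g ∘ f) (j ∘ i) ,
  mk⇔ (i ∘ h ∘ g ∘ f) j

mainTheorem13 : ∀ {n} (G : Graph n) (k : ℕ) → IsCograph G → ChromaticNumber G k → 2 ≤ k →
    (IsTight G k ⇔ Σ (Fin n → Fin k) (λ φ → IsColoring G k φ × IsTightColoring G k φ))
    × (IsTight G k ⇔ (∀ X → IsMaximalClique G X → ∣ X ∣ ≡ k))
    × (IsTight G k ⇔ StronglyCliqued G k)
    × (IsTight G k ⇔ WeaklyCliqued G k)
mainTheorem13 G k cog ((φ , col) , _) 2≤k =
  cycle⇒equivalences
    (λ tight → φ , col , tight φ col)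
    (tightColouring⇒maximalCliques G cog)
    (maximalCliques⇒stronglyCliqued G 2≤k)
    (stronglyCliqued⇒weaklyCliqued G)
    (weaklyCliqued⇒tight G)
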